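{- Let $n,\ell,u$ be integers with $n\ge \ell+u$ (and $\ell,u\ge0$). Fix $L\subseteq\{0,\dots,\ell-1\}$ and $U\subseteq\{n-u,\dots,n-1\}$. Let $R$ be a uniformly randomly chosen subset of $\{\ell,\dots,n-u-1\}$ and set $A:=L\cup R\cup U$. Then for any integer $k$ with $n/2\le k\le n-u-\ell$, \[ \Pr(k\notin A-A)=(1/2)^{|L|+|U|}(3/4)^{n-\ell-u-k}. \]
   Context: $A-A=\{a_1-a_2: a_1,a_2\in A\}$. "Uniformly randomly chosen subset" means each of the $2^{n-\ell-u}$ subsets is chosen with equal probability. -}

module Defs where

open import Data.Nat using (ℕ; zero; suc; _≤_; _<_; _∸_; _≤?_; _<?_)
open import Data.Nat.Properties using ()
open import Data.Integer as ℤ using (ℤ; +_)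
open import Data.Fin using (Fin; toℕ)
open import Data.Fin.Properties using (any?; all?)
open import Data.Fin.Subset using (Subset; _∈_; _∉_; _∪_; inside; outside)
open import Data.Fin.Subset.Properties using (_∈?_)
open import Data.Vec using (_∷_; [])
open import Data.List using (List; _∷_; []; map; _++_; filter; length)
open import Data.Product using (∃; _×_; _,_)
open import Relation.Nullary using (Dec; ¬?; _→-dec_)
open import Relation.Nullary.Decidable using (_×-dec_)

allSubsets : ∀ n → List (Subset n)
allSubsets zero = [] ∷ []
allSubsets (suc n) = map (inside ∷_) (allSubsets n) ++ map (outside ∷_) (allSubsets n)

InDiff : ∀ {n} → ℤ → Subset n → Set
InDiff {n} k A = ∃ λ (a₁ : Fin n) → ∃ λ (a₂ : Fin n) →
  a₁ ∈ A × a₂ ∈ A × ((+ toℕ a₁) ℤ.- (+ toℕ a₂) ≡ k)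
  where open import Relation.Binary.PropositionalEquality using (_≡_)

InDiff? : ∀ {n} (k : ℤ) (A : Subset n) → Dec (InDiff k A)
InDiff? k A = any? λ a₁ → any? λ a₂ →
  (a₁ ∈? A) ×-dec ((a₂ ∈? A) ×-dec (((+ toℕ a₁) ℤ.- (+ toℕ a₂)) ℤ.≟ k))

InMiddle : ∀ n (ℓ u : ℕ) → Subset n → Set
InMiddle n ℓ u R = ∀ i → i ∈ R → ℓ ≤ toℕ i × toℕ i < n ∸ u

InMiddle? : ∀ n ℓ u (R : Subset n) → Dec (InMiddle n ℓ u R)
InMiddle? n ℓ u R = all? λ i → (i ∈? R) →-dec ((ℓ ≤? toℕ i) ×-dec (suc (toℕ i) ≤? n ∸ u))

-- The sample space: all subsets R of {ℓ, …, n-u-1} (there are 2^(n-ℓ-u) of them).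
middleSubsets : ∀ n ℓ u → List (Subset n)
middleSubsets n ℓ u = filter (InMiddle? n ℓ u) (allSubsets n)

favourable : ∀ n ℓ u (L U : Subset n) (k : ℤ) → ℕ
favourable n ℓ u L U k =
  length (filter (λ R → ¬? (InDiff? k (L ∪ R ∪ U))) (middleSubsets n ℓ u))

{-# OPTIONS --safe #-}

-- Since k ≥ n/2, every position t < n − k has its partner t + k among the last n − k positions,
-- and these pairs are disjoint, so k ∉ A − A is a conjunction of independent conditions, one per
-- pair. Cutting R into blocks x ++ y ++ z of lengths n − k, 2k − n, n − k, the indicator of the
-- event is a product over t < n − k of factors depending only on the t-th bits of x and z, so
-- summing over R multiplies local counts: 2 − [t ∈ L] for the ℓ pairs meeting L, 3 for the
-- n − ℓ − u − k pairs inside the random range, 2 − [t + k ∈ U] for the u pairs meeting U, and 2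
-- for each of the 2k − n unpaired positions. Multiplying by 2^(|L| + |U|) turns the first and
-- third kinds into 2 as well.

module Submission where

open import Defs
open import Data.Nat using (ℕ; zero; suc; _+_; _*_; _^_; _∸_; _≤_; _<_; _≤?_; _<?_; z≤n; s≤s; z<s)
open import Data.Nat.Properties
open import Data.Nat.ListAction using (sum)
open import Data.Nat.ListAction.Properties using (sum-++)
open import Data.Nat.Tactic.RingSolver using (solve-∀)
open import Data.Integer as ℤ using (+_; _⊖_)
open import Data.Integer.Properties using (+-injective; ⊖-≥; ⊖-<; [1+m]⊖[1+n]≡m⊖n; m-n≡m⊖n)
open import Data.Bool using (Bool; true; false; _∧_; _∨_; not; T)
open import Data.Bool.Properties using (T-∧; T-≡; T-not-≡; ∨-assoc; ∨-comm; ∨-identityʳ; ∨-zeroʳ)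
open import Data.Fin using (Fin; toℕ)
open import Data.Fin.Properties using (toℕ<n)
open import Data.Fin.Subset using (Subset; _∈_; _∪_; ∣_∣; inside; outside)
open import Data.Vec using ([]; _∷_; _++_; here; there)
open import Data.List as List using ([]; _∷_; length; filter; map)
open import Data.List.Properties using (map-++; map-∘)
open import Data.Product using (∃; ∃₂; _×_; _,_; proj₁; proj₂)
open import Data.Empty using (⊥-elim)
open import Function using (_∘_; _⇔_; mk⇔; Equivalence)
open import Relation.Nullary using (does; ¬_; ¬?; _×-dec_)
open import Relation.Nullary.Decidable using (does-⇔; isYes; fromWitness; toWitness; T?)
open import Level using (0ℓ)
open import Relation.Unary using (Pred; Decidable)
open import Relation.Binary.PropositionalEquality

T-not : ∀ {x} → T (not x) ⇔ (¬ T x)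
T-not {true} = mk⇔ (λ ()) (λ ¬x → ¬x _)
T-not {false} = mk⇔ (λ _ ()) (λ _ → _)

T-not∨ : ∀ {x y} → T (not x ∨ y) ⇔ (T x → T y)
T-not∨ {true} = mk⇔ (λ y _ → y) (λ f → f _)
T-not∨ {false} = mk⇔ (λ _ ()) (λ _ → _)

¬T⇒≡false : ∀ {x} → ¬ T x → x ≡ false
¬T⇒≡false = Equivalence.to T-not-≡ ∘ Equivalence.from T-not

⟦_⟧ : Bool → ℕ
⟦ true ⟧ = 1
⟦ false ⟧ = 0

⟦∧⟧ : ∀ a b → ⟦ a ∧ b ⟧ ≡ ⟦ a ⟧ * ⟦ b ⟧
⟦∧⟧ true b = sym (+-identityʳ ⟦ b ⟧)
⟦∧⟧ false b = refl

∏< : ℕ → (ℕ → ℕ) → ℕ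
∏< zero f = 1
∏< (suc N) f = f 0 * ∏< N (f ∘ suc)

∏<-cong : ∀ N {f g : ℕ → ℕ} → (∀ {t} → t < N → f t ≡ g t) → ∏< N f ≡ ∏< N g
∏<-cong zero eq = refl
∏<-cong (suc N) eq = cong₂ _*_ (eq z<s) (∏<-cong N (eq ∘ s≤s))

∏<-const : ∀ N {f : ℕ → ℕ} {c} → (∀ {t} → t < N → f t ≡ c) → ∏< N f ≡ c ^ N
∏<-const zero eq = refl
∏<-const (suc N) eq = cong₂ _*_ (eq z<s) (∏<-const N (eq ∘ s≤s))

∏<-+ : ∀ a b (f : ℕ → ℕ) → ∏< (a + b) f ≡ ∏< a f * ∏< b (λ i → f (a + i))
∏<-+ zero b f = sym (+-identityʳ _)
∏<-+ (suc a) b f = trans (cong (f 0 *_) (∏<-+ a b (f ∘ suc))) (sym (*-assoc (f 0) _ _))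

∏<-* : ∀ N (f g : ℕ → ℕ) → ∏< N f * ∏< N g ≡ ∏< N (λ t → f t * g t)
∏<-* zero f g = refl
∏<-* (suc N) f g = trans (interchange (f 0) (∏< N (f ∘ suc)) (g 0) (∏< N (g ∘ suc)))
                         (cong (f 0 * g 0 *_) (∏<-* N (f ∘ suc) (g ∘ suc)))
  where
  interchange : ∀ a b c d → (a * b) * (c * d) ≡ (a * c) * (b * d)
  interchange = solve-∀

all< : ℕ → (ℕ → Bool) → Bool
all< zero f = true
all< (suc N) f = f 0 ∧ all< N (f ∘ suc)

T-all< : ∀ N {f : ℕ → Bool} → T (all< N f) ⇔ (∀ {t} → t < N → T (f t))
T-all< zero = mk⇔ (λ _ ()) (λ _ → _)
T-all< (suc N) {f} = mk⇔ to from
  where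
  to : T (all< (suc N) f) → ∀ {t} → t < suc N → T (f t)
  to h {zero} _ = proj₁ (Equivalence.to T-∧ h)
  to h {suc t} (s≤s t<N) = Equivalence.to (T-all< N) (proj₂ (Equivalence.to T-∧ h)) t<N
  from : (∀ {t} → t < suc N → T (f t)) → T (all< (suc N) f)
  from h = Equivalence.from T-∧ (h z<s , Equivalence.from (T-all< N) (h ∘ s≤s))

⟦all<⟧ : ∀ N (f : ℕ → Bool) → ⟦ all< N f ⟧ ≡ ∏< N (λ t → ⟦ f t ⟧)
⟦all<⟧ zero f = refl
⟦all<⟧ (suc N) f = trans (⟦∧⟧ (f 0) _) (cong (⟦ f 0 ⟧ *_) (⟦all<⟧ N (f ∘ suc)))

-- Membership by a natural-number index, false beyond the length of the subset.
infixl 9 _‼_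
_‼_ : ∀ {n} → Subset n → ℕ → Bool
[] ‼ t = false
(b ∷ v) ‼ zero = b
(b ∷ v) ‼ suc t = v ‼ t

∈⇒‼ : ∀ {n} {v : Subset n} {i} → i ∈ v → T (v ‼ toℕ i)
∈⇒‼ here = _
∈⇒‼ (there i∈v) = ∈⇒‼ i∈v

‼⇒∈ : ∀ {n} (v : Subset n) {t} → T (v ‼ t) → ∃ λ i → toℕ i ≡ t × i ∈ v
‼⇒∈ (true ∷ v) {zero} _ = Fin.zero , refl , here
‼⇒∈ (b ∷ v) {suc t} h with ‼⇒∈ v h
... | i , refl , i∈v = Fin.suc i , refl , there i∈v

‼⇒< : ∀ {n} (v : Subset n) {t} → T (v ‼ t) → t < n
‼⇒< v h with ‼⇒∈ v h
... | i , refl , _ = toℕ<n i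

∀∈⇔∀‼ : ∀ {n} (v : Subset n) {P : ℕ → Set} → (∀ i → i ∈ v → P (toℕ i)) ⇔ (∀ t → T (v ‼ t) → P t)
∀∈⇔∀‼ v {P} = mk⇔ to (λ h i i∈v → h (toℕ i) (∈⇒‼ i∈v))
  where
  to : (∀ i → i ∈ v → P (toℕ i)) → ∀ t → T (v ‼ t) → P t
  to h t vt with ‼⇒∈ v vt
  ... | i , refl , i∈v = h i i∈v

‼-∪ : ∀ {n} (v w : Subset n) t → (v ∪ w) ‼ t ≡ v ‼ t ∨ w ‼ t
‼-∪ [] [] t = refl
‼-∪ (a ∷ v) (b ∷ w) zero = refl
‼-∪ (a ∷ v) (b ∷ w) (suc t) = ‼-∪ v w t

‼-++ˡ : ∀ {a b} (v : Subset a) (w : Subset b) {t} → t < a → (v ++ w) ‼ t ≡ v ‼ t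
‼-++ˡ (x ∷ v) w {zero} _ = refl
‼-++ˡ (x ∷ v) w {suc t} (s≤s t<a) = ‼-++ˡ v w t<a

‼-++ʳ : ∀ {a b} (v : Subset a) (w : Subset b) t → (v ++ w) ‼ (a + t) ≡ w ‼ t
‼-++ʳ [] w t = refl
‼-++ʳ (x ∷ v) w t = ‼-++ʳ v w t

∀‼⇔all< : ∀ {n} (v : Subset n) (b : ℕ → Bool) →
  (∀ t → T (v ‼ t) → T (b t)) ⇔ T (all< n (λ t → not (v ‼ t) ∨ b t))
∀‼⇔all< {n} v b = mk⇔
  (λ h → Equivalence.from (T-all< n) λ {t} _ → Equivalence.from T-not∨ (h t))
  (λ h t vt → Equivalence.to T-not∨ (Equivalence.to (T-all< n) h (‼⇒< v vt)) vt)

sumSubsets : ∀ n → (Subset n → ℕ) → ℕ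
sumSubsets zero g = g []
sumSubsets (suc n) g = sumSubsets n (g ∘ (inside ∷_)) + sumSubsets n (g ∘ (outside ∷_))

sumSubsets-cong : ∀ n {f g : Subset n → ℕ} → (∀ v → f v ≡ g v) → sumSubsets n f ≡ sumSubsets n g
sumSubsets-cong zero eq = eq []
sumSubsets-cong (suc n) eq =
  cong₂ _+_ (sumSubsets-cong n (eq ∘ (inside ∷_))) (sumSubsets-cong n (eq ∘ (outside ∷_)))

sumSubsets-*ˡ : ∀ n c (g : Subset n → ℕ) → sumSubsets n (λ v → c * g v) ≡ c * sumSubsets n g
sumSubsets-*ˡ zero c g = refl
sumSubsets-*ˡ (suc n) c g =
  trans (cong₂ _+_ (sumSubsets-*ˡ n c _) (sumSubsets-*ˡ n c _)) (sym (*-distribˡ-+ c _ _))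

sumSubsets-const : ∀ n c → sumSubsets n (λ _ → c) ≡ 2 ^ n * c
sumSubsets-const zero c = sym (+-identityʳ c)
sumSubsets-const (suc n) c =
  trans (cong₂ _+_ (sumSubsets-const n c) (sumSubsets-const n c)) (double (2 ^ n) c)
  where
  double : ∀ x c → x * c + x * c ≡ 2 * x * c
  double = solve-∀

sumSubsets-++ : ∀ a {b} (g : Subset (a + b) → ℕ) →
  sumSubsets (a + b) g ≡ sumSubsets a (λ v → sumSubsets b (λ w → g (v ++ w)))
sumSubsets-++ zero g = refl
sumSubsets-++ (suc a) g =
  cong₂ _+_ (sumSubsets-++ a (g ∘ (inside ∷_))) (sumSubsets-++ a (g ∘ (outside ∷_)))

Σᵇ : (Bool → ℕ) → ℕ
Σᵇ f = f true + f false

sumSubsets-∏< : ∀ n (w : ℕ → Bool → ℕ) →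
  sumSubsets n (λ v → ∏< n (λ t → w t (v ‼ t))) ≡ ∏< n (λ t → Σᵇ (w t))
sumSubsets-∏< zero w = refl
sumSubsets-∏< (suc n) w = begin
  sumSubsets n (λ v → w 0 true * P v) + sumSubsets n (λ v → w 0 false * P v)
    ≡⟨ cong₂ _+_ (sumSubsets-*ˡ n (w 0 true) P) (sumSubsets-*ˡ n (w 0 false) P) ⟩
  w 0 true * sumSubsets n P + w 0 false * sumSubsets n P
    ≡⟨ sym (*-distribʳ-+ (sumSubsets n P) (w 0 true) (w 0 false)) ⟩
  Σᵇ (w 0) * sumSubsets n P
    ≡⟨ cong (Σᵇ (w 0) *_) (sumSubsets-∏< n (w ∘ suc)) ⟩
  Σᵇ (w 0) * ∏< n (λ t → Σᵇ (w (suc t))) ∎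
  where
  open ≡-Reasoning
  P : Subset n → ℕ
  P v = ∏< n (λ t → w (suc t) (v ‼ t))

sumSubsets-∏<₂ : ∀ n (w : ℕ → Bool → Bool → ℕ) →
  sumSubsets n (λ v → sumSubsets n (λ v′ → ∏< n (λ t → w t (v ‼ t) (v′ ‼ t))))
    ≡ ∏< n (λ t → Σᵇ (λ b → Σᵇ (w t b)))
sumSubsets-∏<₂ n w = trans (sumSubsets-cong n (λ v → sumSubsets-∏< n (λ t → w t (v ‼ t))))
                           (sumSubsets-∏< n (λ t b → Σᵇ (w t b)))

module _ {A : Set} {P : Pred A 0ℓ} (P? : Decidable P) where

  length-filter : ∀ xs → length (filter P? xs) ≡ sum (map (λ x → ⟦ does (P? x) ⟧) xs)
  length-filter [] = refl
  length-filter (x ∷ xs) with does (P? x)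
  ... | true = cong suc (length-filter xs)
  ... | false = length-filter xs

  sum-map-filter : ∀ (g : A → ℕ) xs →
    sum (map g (filter P? xs)) ≡ sum (map (λ x → ⟦ does (P? x) ⟧ * g x) xs)
  sum-map-filter g [] = refl
  sum-map-filter g (x ∷ xs) with does (P? x)
  ... | true = cong₂ _+_ (sym (+-identityʳ (g x))) (sum-map-filter g xs)
  ... | false = sum-map-filter g xs

sum-map-allSubsets : ∀ n (g : Subset n → ℕ) → sum (map g (allSubsets n)) ≡ sumSubsets n g
sum-map-allSubsets zero g = +-identityʳ (g [])
sum-map-allSubsets (suc n) g = begin
  sum (map g (map (inside ∷_) S List.++ map (outside ∷_) S))
    ≡⟨ cong sum (map-++ g (map (inside ∷_) S) _) ⟩
  sum (map g (map (inside ∷_) S) List.++ map g (map (outside ∷_) S))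
    ≡⟨ sum-++ (map g (map (inside ∷_) S)) _ ⟩
  sum (map g (map (inside ∷_) S)) + sum (map g (map (outside ∷_) S))
    ≡⟨ sym (cong₂ _+_ (cong sum (map-∘ S)) (cong sum (map-∘ S))) ⟩
  sum (map (g ∘ (inside ∷_)) S) + sum (map (g ∘ (outside ∷_)) S)
    ≡⟨ cong₂ _+_ (sum-map-allSubsets n _) (sum-map-allSubsets n _) ⟩
  sumSubsets (suc n) g ∎
  where
  open ≡-Reasoning
  S = allSubsets n

count-filter : ∀ n {P : Pred (Subset n) 0ℓ} (P? : Decidable P) →
  length (filter P? (allSubsets n)) ≡ sumSubsets n (λ v → ⟦ does (P? v) ⟧)
count-filter n P? = trans (length-filter P? (allSubsets n)) (sum-map-allSubsets n _)

count-filter-filter : ∀ n {P Q : Pred (Subset n) 0ℓ} (P? : Decidable P) (Q? : Decidable Q) →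
  length (filter P? (filter Q? (allSubsets n))) ≡ sumSubsets n (λ v → ⟦ does (Q? v) ⟧ * ⟦ does (P? v) ⟧)
count-filter-filter n P? Q? = begin
  length (filter P? (filter Q? (allSubsets n)))
    ≡⟨ length-filter P? (filter Q? (allSubsets n)) ⟩
  sum (map (λ v → ⟦ does (P? v) ⟧) (filter Q? (allSubsets n)))
    ≡⟨ sum-map-filter Q? _ (allSubsets n) ⟩
  sum (map (λ v → ⟦ does (Q? v) ⟧ * ⟦ does (P? v) ⟧) (allSubsets n))
    ≡⟨ sum-map-allSubsets n _ ⟩
  sumSubsets n (λ v → ⟦ does (Q? v) ⟧ * ⟦ does (P? v) ⟧) ∎
  where open ≡-Reasoning

2^∣∣≡∏< : ∀ {n} (v : Subset n) o a → (∀ t → T (v ‼ t) → o ≤ t × t < o + a) →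
  2 ^ ∣ v ∣ ≡ ∏< a (λ i → 2 ^ ⟦ v ‼ (o + i) ⟧)
2^∣∣≡∏< [] o a _ = sym (trans (∏<-const a (λ _ → refl)) (^-zeroˡ a))
2^∣∣≡∏< (true ∷ v) (suc o) a support with support 0 _
... | () , _
2^∣∣≡∏< (false ∷ v) (suc o) a support = 2^∣∣≡∏< v o a λ t vt →
  let o≤t , t<o+a = support (suc t) vt in ≤-pred o≤t , ≤-pred t<o+a
2^∣∣≡∏< (true ∷ v) zero zero support with support 0 _
... | _ , ()
2^∣∣≡∏< (false ∷ v) zero zero support =
  2^∣∣≡∏< v zero zero λ t vt → ⊥-elim (n≮0 (proj₂ (support (suc t) vt)))
2^∣∣≡∏< (b ∷ v) zero (suc a) support = trans (2^∣∷∣ b) (cong (2 ^ ⟦ b ⟧ *_)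
  (2^∣∣≡∏< v zero a λ t vt → z≤n , ≤-pred (proj₂ (support (suc t) vt))))
  where
  2^∣∷∣ : ∀ b → 2 ^ ∣ b ∷ v ∣ ≡ 2 ^ ⟦ b ⟧ * 2 ^ ∣ v ∣
  2^∣∷∣ true = refl
  2^∣∷∣ false = sym (+-identityʳ _)

∏<-avoiding : ∀ {n} (v : Subset n) o a → (∀ t → T (v ‼ t) → o ≤ t × t < o + a) →
  ∏< a (λ i → 2 ∸ ⟦ v ‼ (o + i) ⟧) * 2 ^ ∣ v ∣ ≡ 2 ^ a
∏<-avoiding v o a support = begin
  ∏< a (λ i → 2 ∸ ⟦ v ‼ (o + i) ⟧) * 2 ^ ∣ v ∣
    ≡⟨ cong (∏< a _ *_) (2^∣∣≡∏< v o a support) ⟩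
  ∏< a (λ i → 2 ∸ ⟦ v ‼ (o + i) ⟧) * ∏< a (λ i → 2 ^ ⟦ v ‼ (o + i) ⟧)
    ≡⟨ ∏<-* a _ _ ⟩
  ∏< a (λ i → (2 ∸ ⟦ v ‼ (o + i) ⟧) * 2 ^ ⟦ v ‼ (o + i) ⟧)
    ≡⟨ ∏<-const a (λ {i} _ → halves (v ‼ (o + i))) ⟩
  2 ^ a ∎
  where
  open ≡-Reasoning
  halves : ∀ b → (2 ∸ ⟦ b ⟧) * 2 ^ ⟦ b ⟧ ≡ 2
  halves true = refl
  halves false = refl

⊖≡+⇒ : ∀ a b {k} → a ⊖ b ≡ + k → a ≡ b + k
⊖≡+⇒ a zero eq = +-injective (trans (sym (⊖-≥ z≤n)) eq)
⊖≡+⇒ zero (suc b) eq with trans (sym (⊖-< z<s)) eq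
... | ()
⊖≡+⇒ (suc a) (suc b) eq = cong suc (⊖≡+⇒ a b (trans (sym ([1+m]⊖[1+n]≡m⊖n a b)) eq))

+-⊖-cancelˡ : ∀ t k → (t + k) ⊖ t ≡ + k
+-⊖-cancelˡ t k = trans (⊖-≥ (m≤m+n t k)) (cong +_ (m+n∸m≡n t k))

InDiff⇔ : ∀ {n} k (A : Subset n) → InDiff (+ k) A ⇔ ∃ λ t → T (A ‼ t ∧ A ‼ (t + k))
InDiff⇔ k A = mk⇔ to from
  where
  to : InDiff (+ k) A → ∃ λ t → T (A ‼ t ∧ A ‼ (t + k))
  to (i , j , i∈A , j∈A , i-j≡k) =
    toℕ j , Equivalence.from T-∧ (∈⇒‼ j∈A , subst (T ∘ (A ‼_)) i≡j+k (∈⇒‼ i∈A))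
    where
    i≡j+k : toℕ i ≡ toℕ j + k
    i≡j+k = ⊖≡+⇒ (toℕ i) (toℕ j) (trans (sym (m-n≡m⊖n (toℕ i) (toℕ j))) i-j≡k)
  from : (∃ λ t → T (A ‼ t ∧ A ‼ (t + k))) → InDiff (+ k) A
  from (t , h) with Equivalence.to T-∧ h
  ... | At , At+k with ‼⇒∈ A At | ‼⇒∈ A At+k
  ...   | j , refl , j∈A | i , i≡j+k , i∈A =
          i , j , i∈A , j∈A , (begin
            + toℕ i ℤ.- + toℕ j        ≡⟨ cong (λ a → + a ℤ.- + toℕ j) i≡j+k ⟩
            + (toℕ j + k) ℤ.- + toℕ j  ≡⟨ m-n≡m⊖n (toℕ j + k) (toℕ j) ⟩
            (toℕ j + k) ⊖ toℕ j        ≡⟨ +-⊖-cancelˡ (toℕ j) k ⟩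
            + k ∎)
    where open ≡-Reasoning

¬InDiff⇔all< : ∀ p k (A : Subset (p + k)) →
  (¬ InDiff (+ k) A) ⇔ T (all< p (λ t → not (A ‼ t ∧ A ‼ (t + k))))
¬InDiff⇔all< p k A = mk⇔ to from
  where
  to : ¬ InDiff (+ k) A → T (all< p (λ t → not (A ‼ t ∧ A ‼ (t + k))))
  to ¬d = Equivalence.from (T-all< p) λ {t} _ →
    Equivalence.from T-not (λ h → ¬d (Equivalence.from (InDiff⇔ k A) (t , h)))
  from : T (all< p (λ t → not (A ‼ t ∧ A ‼ (t + k)))) → ¬ InDiff (+ k) A
  from all<p d with Equivalence.to (InDiff⇔ k A) d
  ... | t , h = Equivalence.to T-not (Equivalence.to (T-all< p) all<p t<p) h
    where
    t<p : t < p
    t<p = +-cancelʳ-< k t p (‼⇒< A (proj₂ (Equivalence.to T-∧ h)))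

-- Indicator for a pair of positions (t, t + k): μ, μ′ say whether the positions may lie in R,
-- s, s′ whether they already lie in L ∪ U, and b, b′ are the choices of R there.
admissible : (μ μ′ s s′ b b′ : Bool) → ℕ
admissible μ μ′ s s′ b b′ = ⟦ not b ∨ μ ⟧ * (⟦ not b′ ∨ μ′ ⟧ * ⟦ not ((s ∨ b) ∧ (s′ ∨ b′)) ⟧)

admissibleCount : (μ μ′ s s′ : Bool) → ℕ
admissibleCount μ μ′ s s′ = Σᵇ (λ b → Σᵇ (admissible μ μ′ s s′ b))

admissibleCount-fixedˡ : ∀ s → admissibleCount false true s false ≡ 2 ∸ ⟦ s ⟧
admissibleCount-fixedˡ true = refl
admissibleCount-fixedˡ false = refl

admissibleCount-free : admissibleCount true true false false ≡ 3
admissibleCount-free = refl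

admissibleCount-fixedʳ : ∀ s → admissibleCount true false false s ≡ 2 ∸ ⟦ s ⟧
admissibleCount-fixedʳ true = refl
admissibleCount-fixedʳ false = refl

-- Here n = p + (m + p) and k = m + p: position t < p is paired with opp t = t + k, the m positions
-- from p to k are unpaired, and R ranges over the subsets of [ℓ, ℓ + N₀) = [ℓ, n − u). Of the
-- pairs, the first ℓ meet L, the next e lie inside [ℓ, n − u), and the last u meet U.
module Layout (ℓ e u m : ℕ) where

  p k n N₀ : ℕ
  p = ℓ + (e + u)
  k = m + p
  n = p + k
  N₀ = (e + u) + (m + (ℓ + e))

  opp : ℕ → ℕ
  opp t = p + (m + t)

  n≡ℓ+N₀+u : n ≡ ℓ + N₀ + u
  n≡ℓ+N₀+u = shuffle ℓ e u m
    where
    shuffle : ∀ ℓ e u m → (ℓ + (e + u)) + (m + (ℓ + (e + u))) ≡ ℓ + ((e + u) + (m + (ℓ + e))) + u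
    shuffle = solve-∀

  n∸u≡ℓ+N₀ : n ∸ u ≡ ℓ + N₀
  n∸u≡ℓ+N₀ = trans (cong (_∸ u) n≡ℓ+N₀+u) (m+n∸n≡m (ℓ + N₀) u)

  t+k≡opp : ∀ t → t + k ≡ opp t
  t+k≡opp t = shuffle t m p
    where
    shuffle : ∀ t m p → t + (m + p) ≡ p + (m + t)
    shuffle = solve-∀

  opp-above : ∀ i → opp (ℓ + (e + i)) ≡ ℓ + N₀ + i
  opp-above i = shuffle ℓ e u m i
    where
    shuffle : ∀ ℓ e u m i → (ℓ + (e + u)) + (m + (ℓ + (e + i))) ≡ ℓ + ((e + u) + (m + (ℓ + e))) + i
    shuffle = solve-∀

  ℓ≤opp : ∀ t → ℓ ≤ opp t
  ℓ≤opp t = ≤-trans (m≤m+n ℓ (e + u)) (m≤m+n p (m + t))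

  opp<ℓ+N₀ : ∀ {t} → t < ℓ + e → opp t < ℓ + N₀
  opp<ℓ+N₀ {t} t<ℓ+e = subst (_< ℓ + N₀) (sym (+-assoc ℓ (e + u) (m + t)))
    (+-monoʳ-< ℓ (+-monoʳ-< (e + u) (+-monoʳ-< m t<ℓ+e)))

  powers-balance : 2 ^ m * (2 ^ ℓ * (3 ^ e * 2 ^ u)) * 4 ^ e ≡ 3 ^ e * 2 ^ N₀
  powers-balance = begin
    2 ^ m * (2 ^ ℓ * (3 ^ e * 2 ^ u)) * 4 ^ e
      ≡⟨ cong (2 ^ m * (2 ^ ℓ * (3 ^ e * 2 ^ u)) *_) 4^e≡2^e*2^e ⟩
    2 ^ m * (2 ^ ℓ * (3 ^ e * 2 ^ u)) * (2 ^ e * 2 ^ e)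
      ≡⟨ regroup (2 ^ m) (2 ^ ℓ) (3 ^ e) (2 ^ u) (2 ^ e) ⟩
    3 ^ e * ((2 ^ e * 2 ^ u) * (2 ^ m * (2 ^ ℓ * 2 ^ e)))
      ≡⟨ cong (3 ^ e *_) (sym 2^N₀≡) ⟩
    3 ^ e * 2 ^ N₀ ∎
    where
    open ≡-Reasoning
    4^e≡2^e*2^e : 4 ^ e ≡ 2 ^ e * 2 ^ e
    4^e≡2^e*2^e = trans (^-*-assoc 2 2 e) (trans (cong (2 ^_) (double e)) (^-distribˡ-+-* 2 e e))
      where
      double : ∀ e → 2 * e ≡ e + e
      double = solve-∀
    2^N₀≡ : 2 ^ N₀ ≡ (2 ^ e * 2 ^ u) * (2 ^ m * (2 ^ ℓ * 2 ^ e))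
    2^N₀≡ = trans (^-distribˡ-+-* 2 (e + u) _) (cong₂ _*_ (^-distribˡ-+-* 2 e u)
              (trans (^-distribˡ-+-* 2 m _) (cong (2 ^ m *_) (^-distribˡ-+-* 2 ℓ e))))
    regroup : ∀ a b c d x → a * (b * (c * d)) * (x * x) ≡ c * ((x * d) * (a * (b * x)))
    regroup = solve-∀

  mid : ℕ → Bool
  mid t = isYes ((ℓ ≤? t) ×-dec (t <? ℓ + N₀))

  mid-inside : ∀ {t} → ℓ ≤ t → t < ℓ + N₀ → mid t ≡ true
  mid-inside ℓ≤t t<ℓ+N₀ = Equivalence.to T-≡ (fromWitness (ℓ≤t , t<ℓ+N₀))

  mid-below : ∀ {t} → t < ℓ → mid t ≡ false
  mid-below t<ℓ = ¬T⇒≡false λ h → <⇒≱ t<ℓ (proj₁ (toWitness h))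

  mid-above : ∀ {t} → ℓ + N₀ ≤ t → mid t ≡ false
  mid-above ℓ+N₀≤t = ¬T⇒≡false λ h → <⇒≱ (proj₂ (toWitness h)) ℓ+N₀≤t

  InRange : ℕ → Set
  InRange t = ℓ ≤ t × t < n ∸ u

  InRange⇔mid : ∀ {t} → InRange t ⇔ T (mid t)
  InRange⇔mid {t} = mk⇔
    (λ (ℓ≤t , t<n∸u) → fromWitness (ℓ≤t , subst (t <_) n∸u≡ℓ+N₀ t<n∸u))
    (λ h → let ℓ≤t , t<ℓ+N₀ = toWitness {a? = (ℓ ≤? t) ×-dec (t <? ℓ + N₀)} h
           in ℓ≤t , subst (t <_) (sym n∸u≡ℓ+N₀) t<ℓ+N₀)

  InMiddle⇔ : ∀ R → InMiddle n ℓ u R ⇔ T (all< n (λ t → not (R ‼ t) ∨ mid t))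
  InMiddle⇔ R = mk⇔
    (λ h → Equivalence.to (∀‼⇔all< R mid) λ t Rt →
      Equivalence.to InRange⇔mid (Equivalence.to (∀∈⇔∀‼ R {InRange}) h t Rt))
    (λ h → Equivalence.from (∀∈⇔∀‼ R {InRange}) λ t Rt →
      Equivalence.from InRange⇔mid (Equivalence.from (∀‼⇔all< R mid) h t Rt))

  ⟦InMiddle⟧ : ∀ R → ⟦ does (InMiddle? n ℓ u R) ⟧ ≡ ∏< n (λ t → ⟦ not (R ‼ t) ∨ mid t ⟧)
  ⟦InMiddle⟧ R = trans (cong ⟦_⟧ (does-⇔ (InMiddle⇔ R) (InMiddle? n ℓ u R) (T? _))) (⟦all<⟧ n _)

  middle-count : length (middleSubsets n ℓ u) ≡ 2 ^ N₀
  middle-count = begin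
    length (middleSubsets n ℓ u)
      ≡⟨ count-filter n (InMiddle? n ℓ u) ⟩
    sumSubsets n (λ R → ⟦ does (InMiddle? n ℓ u R) ⟧)
      ≡⟨ sumSubsets-cong n ⟦InMiddle⟧ ⟩
    sumSubsets n (λ R → ∏< n (λ t → ⟦ not (R ‼ t) ∨ mid t ⟧))
      ≡⟨ sumSubsets-∏< n (λ t b → ⟦ not b ∨ mid t ⟧) ⟩
    ∏< n choices
      ≡⟨ cong (λ N → ∏< N choices) (trans n≡ℓ+N₀+u (+-assoc ℓ N₀ u)) ⟩
    ∏< (ℓ + (N₀ + u)) choices
      ≡⟨ trans (∏<-+ ℓ (N₀ + u) choices) (cong (∏< ℓ choices *_) (∏<-+ N₀ u (λ s → choices (ℓ + s)))) ⟩
    ∏< ℓ choices * (∏< N₀ (λ s → choices (ℓ + s)) * ∏< u (λ i → choices (ℓ + (N₀ + i))))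
      ≡⟨ cong₂ _*_ (∏<-const ℓ λ t<ℓ → cong (λ b → ⟦ b ⟧ + 1) (mid-below t<ℓ))
           (cong₂ _*_ (∏<-const N₀ λ {s} s<N₀ →
                         cong (λ b → ⟦ b ⟧ + 1) (mid-inside (m≤m+n ℓ s) (+-monoʳ-< ℓ s<N₀)))
                      (∏<-const u λ {i} _ → cong (λ b → ⟦ b ⟧ + 1) (mid-above (+-monoʳ-≤ ℓ (m≤m+n N₀ i))))) ⟩
    1 ^ ℓ * (2 ^ N₀ * 1 ^ u)
      ≡⟨ cong₂ (λ a b → a * (2 ^ N₀ * b)) (^-zeroˡ ℓ) (^-zeroˡ u) ⟩
    1 * (2 ^ N₀ * 1)
      ≡⟨ trans (*-identityˡ _) (*-identityʳ _) ⟩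
    2 ^ N₀ ∎
    where
    open ≡-Reasoning
    choices : ℕ → ℕ
    choices t = ⟦ mid t ⟧ + 1

  module _ (L U : Subset n) (L⊆ : ∀ i → i ∈ L → toℕ i < ℓ) (U⊆ : ∀ i → i ∈ U → n ∸ u ≤ toℕ i) where

    S : Subset n
    S = L ∪ U

    L-support : ∀ t → T (L ‼ t) → t < ℓ
    L-support = Equivalence.to (∀∈⇔∀‼ L) L⊆

    U-support : ∀ t → T (U ‼ t) → ℓ + N₀ ≤ t × t < ℓ + N₀ + u
    U-support t Ut = subst (_≤ t) n∸u≡ℓ+N₀ (Equivalence.to (∀∈⇔∀‼ U) U⊆ t Ut)
                   , subst (t <_) n≡ℓ+N₀+u (‼⇒< U Ut)

    S-below : ∀ {t} → t < ℓ → S ‼ t ≡ L ‼ t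
    S-below {t} t<ℓ = begin
      S ‼ t            ≡⟨ ‼-∪ L U t ⟩
      L ‼ t ∨ U ‼ t    ≡⟨ cong (L ‼ t ∨_) (¬T⇒≡false λ Ut → <⇒≱ t<ℓ+N₀ (proj₁ (U-support t Ut))) ⟩
      L ‼ t ∨ false    ≡⟨ ∨-identityʳ (L ‼ t) ⟩
      L ‼ t ∎
      where
      open ≡-Reasoning
      t<ℓ+N₀ : t < ℓ + N₀
      t<ℓ+N₀ = <-≤-trans t<ℓ (m≤m+n ℓ N₀)

    S-inside : ∀ {t} → ℓ ≤ t → t < ℓ + N₀ → S ‼ t ≡ false
    S-inside {t} ℓ≤t t<ℓ+N₀ = trans (‼-∪ L U t) (cong₂ _∨_
      (¬T⇒≡false λ Lt → <⇒≱ (L-support t Lt) ℓ≤t)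
      (¬T⇒≡false λ Ut → <⇒≱ t<ℓ+N₀ (proj₁ (U-support t Ut))))

    S-above : ∀ {t} → ℓ + N₀ ≤ t → S ‼ t ≡ U ‼ t
    S-above {t} ℓ+N₀≤t = trans (‼-∪ L U t) (cong (_∨ U ‼ t)
      (¬T⇒≡false λ Lt → <⇒≱ (L-support t Lt) (≤-trans (m≤m+n ℓ N₀) ℓ+N₀≤t)))

    cell : ℕ → Bool → Bool → ℕ
    cell t = admissible (mid t) (mid (opp t)) (S ‼ t) (S ‼ opp t)

    cellCount : ℕ → ℕ
    cellCount t = admissibleCount (mid t) (mid (opp t)) (S ‼ t) (S ‼ opp t)

    module Blocks (x : Subset p) (y : Subset m) (z : Subset p) where

      R : Subset n
      R = x ++ (y ++ z)

      R-first : ∀ {t} → t < p → R ‼ t ≡ x ‼ t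
      R-first = ‼-++ˡ x (y ++ z)

      R-last : ∀ t → R ‼ opp t ≡ z ‼ t
      R-last t = trans (‼-++ʳ x (y ++ z) (m + t)) (‼-++ʳ y z t)

      ⟦InMiddle-blocks⟧ : ⟦ does (InMiddle? n ℓ u R) ⟧
        ≡ ∏< p (λ t → ⟦ not (x ‼ t) ∨ mid t ⟧) * ∏< p (λ t → ⟦ not (z ‼ t) ∨ mid (opp t) ⟧)
      ⟦InMiddle-blocks⟧ = begin
        ⟦ does (InMiddle? n ℓ u R) ⟧
          ≡⟨ ⟦InMiddle⟧ R ⟩
        ∏< n f
          ≡⟨ trans (∏<-+ p k f) (cong (∏< p f *_) (∏<-+ m p (λ t → f (p + t)))) ⟩
        ∏< p f * (∏< m (λ t → f (p + t)) * ∏< p (λ t → f (opp t)))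
          ≡⟨ cong₂ _*_ (∏<-cong p first) (cong₂ _*_ (∏<-const m middle) (∏<-cong p last)) ⟩
        ∏< p fx * (1 ^ m * ∏< p fz)
          ≡⟨ cong (λ a → ∏< p fx * (a * ∏< p fz)) (^-zeroˡ m) ⟩
        ∏< p fx * (1 * ∏< p fz)
          ≡⟨ cong (∏< p fx *_) (*-identityˡ (∏< p fz)) ⟩
        ∏< p fx * ∏< p fz ∎
        where
        open ≡-Reasoning
        f fx fz : ℕ → ℕ
        f t = ⟦ not (R ‼ t) ∨ mid t ⟧
        fx t = ⟦ not (x ‼ t) ∨ mid t ⟧
        fz t = ⟦ not (z ‼ t) ∨ mid (opp t) ⟧
        first : ∀ {t} → t < p → f t ≡ fx t
        first {t} t<p = cong (λ b → ⟦ not b ∨ mid t ⟧) (R-first t<p)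
        last : ∀ {t} → t < p → f (opp t) ≡ fz t
        last {t} _ = cong (λ b → ⟦ not b ∨ mid (opp t) ⟧) (R-last t)
        middle : ∀ {t} → t < m → f (p + t) ≡ 1
        middle {t} t<m = trans (cong (λ b → ⟦ not (R ‼ (p + t)) ∨ b ⟧) (mid-inside ℓ≤p+t p+t<ℓ+N₀))
                               (cong ⟦_⟧ (∨-zeroʳ (not (R ‼ (p + t)))))
          where
          ℓ≤p+t : ℓ ≤ p + t
          ℓ≤p+t = ≤-trans (m≤m+n ℓ (e + u)) (m≤m+n p t)
          p+t<ℓ+N₀ : p + t < ℓ + N₀
          p+t<ℓ+N₀ = subst (_< ℓ + N₀) (sym (+-assoc ℓ (e + u) t))
            (+-monoʳ-< ℓ (+-monoʳ-< (e + u) (<-≤-trans t<m (m≤m+n m (ℓ + e)))))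

      ⟦¬InDiff-blocks⟧ : ⟦ does (¬? (InDiff? (+ k) (L ∪ R ∪ U))) ⟧
        ≡ ∏< p (λ t → ⟦ not ((S ‼ t ∨ x ‼ t) ∧ (S ‼ opp t ∨ z ‼ t)) ⟧)
      ⟦¬InDiff-blocks⟧ = begin
        ⟦ does (¬? (InDiff? (+ k) A)) ⟧
          ≡⟨ cong ⟦_⟧ (does-⇔ (¬InDiff⇔all< p k A) (¬? (InDiff? (+ k) A)) (T? _)) ⟩
        ⟦ all< p (λ t → not (A ‼ t ∧ A ‼ (t + k))) ⟧
          ≡⟨ ⟦all<⟧ p _ ⟩
        ∏< p (λ t → ⟦ not (A ‼ t ∧ A ‼ (t + k)) ⟧)
          ≡⟨ ∏<-cong p (λ {t} t<p → cong₂ (λ a b → ⟦ not (a ∧ b) ⟧)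
               (trans (A‼ t) (cong (S ‼ t ∨_) (R-first t<p)))
               (trans (cong (A ‼_) (t+k≡opp t)) (trans (A‼ (opp t)) (cong (S ‼ opp t ∨_) (R-last t))))) ⟩
        ∏< p (λ t → ⟦ not ((S ‼ t ∨ x ‼ t) ∧ (S ‼ opp t ∨ z ‼ t)) ⟧) ∎
        where
        open ≡-Reasoning
        A : Subset n
        A = L ∪ R ∪ U
        A‼ : ∀ t → A ‼ t ≡ S ‼ t ∨ R ‼ t
        A‼ t = begin
          A ‼ t                      ≡⟨ trans (‼-∪ L (R ∪ U) t) (cong (L ‼ t ∨_) (‼-∪ R U t)) ⟩
          L ‼ t ∨ (R ‼ t ∨ U ‼ t)    ≡⟨ cong (L ‼ t ∨_) (∨-comm (R ‼ t) (U ‼ t)) ⟩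
          L ‼ t ∨ (U ‼ t ∨ R ‼ t)    ≡⟨ sym (∨-assoc (L ‼ t) (U ‼ t) (R ‼ t)) ⟩
          (L ‼ t ∨ U ‼ t) ∨ R ‼ t    ≡⟨ cong (_∨ R ‼ t) (sym (‼-∪ L U t)) ⟩
          S ‼ t ∨ R ‼ t ∎

      indicator≡∏<cell : ⟦ does (InMiddle? n ℓ u R) ⟧ * ⟦ does (¬? (InDiff? (+ k) (L ∪ R ∪ U))) ⟧
        ≡ ∏< p (λ t → cell t (x ‼ t) (z ‼ t))
      indicator≡∏<cell = begin
        ⟦ does (InMiddle? n ℓ u R) ⟧ * ⟦ does (¬? (InDiff? (+ k) (L ∪ R ∪ U))) ⟧
          ≡⟨ cong₂ _*_ ⟦InMiddle-blocks⟧ ⟦¬InDiff-blocks⟧ ⟩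
        (∏< p f * ∏< p g) * ∏< p h
          ≡⟨ *-assoc (∏< p f) _ _ ⟩
        ∏< p f * (∏< p g * ∏< p h)
          ≡⟨ cong (∏< p f *_) (∏<-* p g h) ⟩
        ∏< p f * ∏< p (λ t → g t * h t)
          ≡⟨ ∏<-* p f _ ⟩
        ∏< p (λ t → cell t (x ‼ t) (z ‼ t)) ∎
        where
        open ≡-Reasoning
        f g h : ℕ → ℕ
        f t = ⟦ not (x ‼ t) ∨ mid t ⟧
        g t = ⟦ not (z ‼ t) ∨ mid (opp t) ⟧
        h t = ⟦ not ((S ‼ t ∨ x ‼ t) ∧ (S ‼ opp t ∨ z ‼ t)) ⟧

    favourable≡2^m*∏<cellCount : favourable n ℓ u L U (+ k) ≡ 2 ^ m * ∏< p cellCount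
    favourable≡2^m*∏<cellCount = begin
      favourable n ℓ u L U (+ k)
        ≡⟨ count-filter-filter n (λ R → ¬? (InDiff? (+ k) (L ∪ R ∪ U))) (InMiddle? n ℓ u) ⟩
      sumSubsets n F
        ≡⟨ trans (sumSubsets-++ p F) (sumSubsets-cong p λ x → sumSubsets-++ m (λ w → F (x ++ w))) ⟩
      sumSubsets p (λ x → sumSubsets m (λ y → sumSubsets p (λ z → F (x ++ (y ++ z)))))
        ≡⟨ sumSubsets-cong p (λ x → sumSubsets-cong m λ y → sumSubsets-cong p λ z →
             Blocks.indicator≡∏<cell x y z) ⟩
      sumSubsets p (λ x → sumSubsets m (λ _ → sumSubsets p (λ z → C x z)))
        ≡⟨ sumSubsets-cong p (λ x → sumSubsets-const m (sumSubsets p (C x))) ⟩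
      sumSubsets p (λ x → 2 ^ m * sumSubsets p (C x))
        ≡⟨ sumSubsets-*ˡ p (2 ^ m) (λ x → sumSubsets p (C x)) ⟩
      2 ^ m * sumSubsets p (λ x → sumSubsets p (C x))
        ≡⟨ cong (2 ^ m *_) (sumSubsets-∏<₂ p cell) ⟩
      2 ^ m * ∏< p cellCount ∎
      where
      open ≡-Reasoning
      F : Subset n → ℕ
      F R = ⟦ does (InMiddle? n ℓ u R) ⟧ * ⟦ does (¬? (InDiff? (+ k) (L ∪ R ∪ U))) ⟧
      C : Subset p → Subset p → ℕ
      C x z = ∏< p (λ t → cell t (x ‼ t) (z ‼ t))

    mid-S-opp : ∀ {t} → t < ℓ + e → mid (opp t) ≡ true × S ‼ opp t ≡ false
    mid-S-opp {t} t<ℓ+e = mid-inside (ℓ≤opp t) (opp<ℓ+N₀ t<ℓ+e) , S-inside (ℓ≤opp t) (opp<ℓ+N₀ t<ℓ+e)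

    mid-S-inside : ∀ {s} → s < N₀ → mid (ℓ + s) ≡ true × S ‼ (ℓ + s) ≡ false
    mid-S-inside {s} s<N₀ = mid-inside (m≤m+n ℓ s) (+-monoʳ-< ℓ s<N₀) , S-inside (m≤m+n ℓ s) (+-monoʳ-< ℓ s<N₀)

    cellCount-below : ∀ {t} → t < ℓ → cellCount t ≡ 2 ∸ ⟦ L ‼ t ⟧
    cellCount-below {t} t<ℓ with mid-S-opp (<-≤-trans t<ℓ (m≤m+n ℓ e))
    ... | mid-opp , S-opp rewrite mid-below t<ℓ | S-below t<ℓ | mid-opp | S-opp = admissibleCount-fixedˡ (L ‼ t)

    cellCount-free : ∀ {i} → i < e → cellCount (ℓ + i) ≡ 3
    cellCount-free {i} i<e with mid-S-inside (<-≤-trans i<e (≤-trans (m≤m+n e u) (m≤m+n (e + u) _)))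
                          | mid-S-opp (+-monoʳ-< ℓ i<e)
    ... | mid-t , S-t | mid-opp , S-opp rewrite mid-t | S-t | mid-opp | S-opp = admissibleCount-free

    cellCount-above : ∀ {i} → i < u → cellCount (ℓ + (e + i)) ≡ 2 ∸ ⟦ U ‼ (ℓ + N₀ + i) ⟧
    cellCount-above {i} i<u with mid-S-inside (<-≤-trans (+-monoʳ-< e i<u) (m≤m+n (e + u) _))
    ... | mid-t , S-t
      rewrite mid-t | S-t | opp-above i | mid-above (m≤m+n (ℓ + N₀) i) | S-above (m≤m+n (ℓ + N₀) i) =
      admissibleCount-fixedʳ (U ‼ (ℓ + N₀ + i))

    favourable-weighted : favourable n ℓ u L U (+ k) * 2 ^ (∣ L ∣ + ∣ U ∣) ≡ 2 ^ m * (2 ^ ℓ * (3 ^ e * 2 ^ u))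
    favourable-weighted = begin
      favourable n ℓ u L U (+ k) * 2 ^ (∣ L ∣ + ∣ U ∣)
        ≡⟨ cong₂ _*_ favourable≡2^m*∏<cellCount (^-distribˡ-+-* 2 ∣ L ∣ ∣ U ∣) ⟩
      2 ^ m * ∏< p cellCount * (2 ^ ∣ L ∣ * 2 ^ ∣ U ∣)
        ≡⟨ cong (λ a → 2 ^ m * a * (2 ^ ∣ L ∣ * 2 ^ ∣ U ∣))
             (trans (∏<-+ ℓ (e + u) cellCount) (cong (∏< ℓ cellCount *_) (∏<-+ e u (λ i → cellCount (ℓ + i))))) ⟩
      2 ^ m * (∏< ℓ cellCount * (∏< e (λ i → cellCount (ℓ + i))
               * ∏< u (λ i → cellCount (ℓ + (e + i))))) * (2 ^ ∣ L ∣ * 2 ^ ∣ U ∣)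
        ≡⟨ cong₂ (λ a b → 2 ^ m * (a * b) * (2 ^ ∣ L ∣ * 2 ^ ∣ U ∣)) (∏<-cong ℓ cellCount-below)
                 (cong₂ _*_ (∏<-const e cellCount-free) (∏<-cong u cellCount-above)) ⟩
      2 ^ m * (ΠL * (3 ^ e * ΠU)) * (2 ^ ∣ L ∣ * 2 ^ ∣ U ∣)
        ≡⟨ regroup (2 ^ m) ΠL (3 ^ e) ΠU (2 ^ ∣ L ∣) (2 ^ ∣ U ∣) ⟩
      2 ^ m * (ΠL * 2 ^ ∣ L ∣ * (3 ^ e * (ΠU * 2 ^ ∣ U ∣)))
        ≡⟨ cong₂ (λ a b → 2 ^ m * (a * (3 ^ e * b)))
                 (∏<-avoiding L 0 ℓ λ t Lt → z≤n , L-support t Lt)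
                 (∏<-avoiding U (ℓ + N₀) u U-support) ⟩
      2 ^ m * (2 ^ ℓ * (3 ^ e * 2 ^ u)) ∎
      where
      open ≡-Reasoning
      ΠL ΠU : ℕ
      ΠL = ∏< ℓ (λ t → 2 ∸ ⟦ L ‼ t ⟧)
      ΠU = ∏< u (λ i → 2 ∸ ⟦ U ‼ (ℓ + N₀ + i) ⟧)
      regroup : ∀ a b c d x y → a * (b * (c * d)) * (x * y) ≡ a * (b * x * (c * (d * y)))
      regroup = solve-∀

decompose : ∀ {n} ℓ u {k} → ℓ + u ≤ n → n ≤ 2 * k → k ≤ n ∸ u ∸ ℓ →
  ∃₂ λ e m → n ≡ (ℓ + (e + u)) + (m + (ℓ + (e + u))) × k ≡ m + (ℓ + (e + u)) × n ∸ ℓ ∸ u ∸ k ≡ e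
decompose {n} ℓ u {k} ℓ+u≤n n≤2k k≤n∸u∸ℓ = e , m , trans n≡p+k (cong (_+_ p) k≡m+p) , k≡m+p , refl
  where
  e m p : ℕ
  e = n ∸ ℓ ∸ u ∸ k
  m = 2 * k ∸ n
  p = ℓ + (e + u)
  k≤n∸ℓ∸u : k ≤ n ∸ ℓ ∸ u
  k≤n∸ℓ∸u = subst (k ≤_)
    (trans (∸-+-assoc n u ℓ) (trans (cong (n ∸_) (+-comm u ℓ)) (sym (∸-+-assoc n ℓ u)))) k≤n∸u∸ℓ
  n≡e+k+u+ℓ : n ≡ e + k + u + ℓ
  n≡e+k+u+ℓ = sym (begin
    e + k + u + ℓ    ≡⟨ cong (λ a → a + u + ℓ) (m∸n+n≡m k≤n∸ℓ∸u) ⟩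
    n ∸ ℓ ∸ u + u + ℓ ≡⟨ cong (_+ ℓ) (m∸n+n≡m (m+n≤o⇒m≤o∸n u (subst (_≤ n) (+-comm ℓ u) ℓ+u≤n))) ⟩
    n ∸ ℓ + ℓ        ≡⟨ m∸n+n≡m (≤-trans (m≤m+n ℓ u) ℓ+u≤n) ⟩
    n ∎)
    where open ≡-Reasoning
  n≡p+k : n ≡ p + k
  n≡p+k = trans n≡e+k+u+ℓ (shuffle e k u ℓ)
    where
    shuffle : ∀ e k u ℓ → e + k + u + ℓ ≡ (ℓ + (e + u)) + k
    shuffle = solve-∀
  k≡m+p : k ≡ m + p
  k≡m+p = +-cancelʳ-≡ k k (m + p) (begin
    k + k          ≡⟨ cong (_+_ k) (sym (+-identityʳ k)) ⟩
    2 * k          ≡⟨ sym (m∸n+n≡m n≤2k) ⟩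
    m + n          ≡⟨ cong (_+_ m) n≡p+k ⟩
    m + (p + k)    ≡⟨ sym (+-assoc m p k) ⟩
    m + p + k ∎)
    where open ≡-Reasoning

lemma9 : (n ℓ u : ℕ) → ℓ + u ≤ n →
    (L U : Subset n) →
    (∀ i → i ∈ L → toℕ i < ℓ) →
    (∀ i → i ∈ U → n ∸ u ≤ toℕ i) →
    (k : ℕ) → n ≤ 2 * k → k ≤ n ∸ u ∸ ℓ →
    favourable n ℓ u L U (+ k) * (2 ^ (∣ L ∣ + ∣ U ∣) * 4 ^ (n ∸ ℓ ∸ u ∸ k))
      ≡ 3 ^ (n ∸ ℓ ∸ u ∸ k) * length (middleSubsets n ℓ u)
lemma9 n ℓ u ℓ+u≤n L U L⊆ U⊆ k n≤2k k≤n∸u∸ℓ with decompose ℓ u ℓ+u≤n n≤2k k≤n∸u∸ℓ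
... | e , m , refl , refl , n∸ℓ∸u∸k≡e rewrite n∸ℓ∸u∸k≡e = begin
  favourable n ℓ u L U (+ k) * (2 ^ (∣ L ∣ + ∣ U ∣) * 4 ^ e)
    ≡⟨ sym (*-assoc (favourable n ℓ u L U (+ k)) _ _) ⟩
  favourable n ℓ u L U (+ k) * 2 ^ (∣ L ∣ + ∣ U ∣) * 4 ^ e
    ≡⟨ cong (_* 4 ^ e) (favourable-weighted L U L⊆ U⊆) ⟩
  2 ^ m * (2 ^ ℓ * (3 ^ e * 2 ^ u)) * 4 ^ e
    ≡⟨ powers-balance ⟩
  3 ^ e * 2 ^ N₀
    ≡⟨ cong (3 ^ e *_) (sym middle-count) ⟩
  3 ^ e * length (middleSubsets n ℓ u) ∎
  where
  open Layout ℓ e u m using (N₀; powers-balance; middle-count; favourable-weighted)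
  open ≡-Reasoning
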